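{- Let $m\ge 3$, let $G$ be a finite abelian group of order $n$, and let $A_1,\dots,A_m$ be pairwise disjoint nonempty subsets of $G$ with sizes $k_1,\dots,k_m$ that form a bimodal collection. Then $\{A_1,\dots,A_m\}$ is an $(n,m;k_1,\dots,k_m;1)$-RWEDF if and only if every $A_i$ is a singleton and the elements of $A_1\cup\dots\cup A_m$ form an $(n,m,1)$ difference set in $G$.
   Context: $G$ is written additively, $G^*=G\setminus\{0\}$. For $\delta\in G^*$, $N_j(\delta)=|\{(a,b): a\in A_j,\ b\in A_i \text{ for some } i\neq j,\ a-b=\delta\}|$. The collection is bimodal if $N_j(\delta)\in\{0,k_j\}$ for all $\delta\in G^*$ and all $j$. An $(n,m;k_1,\dots,k_m;\ell)$-RWEDF is such a collection with $\sum_i \frac{1}{k_i}N_i(\delta)=\ell$ for all $\delta\in G^*$. An $(n,k,\lambda)$ difference set is a $k$-subset $D$ of $G$ such that every element of $G^*$ equals $d_1-d_2$ ($d_1,d_2\in D$) in exactly $\lambda$ ways. -}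

module Defs where

open import Data.Nat using (ℕ; zero; suc; _+_)
open import Data.Integer using (+_)
open import Data.Rational using (ℚ; 0ℚ; _/_) renaming (_+_ to _+ℚ_)
open import Data.Fin using (Fin; zero; suc; _≟_)
open import Data.Fin.Subset using (Subset; _∈_; ∣_∣; ⋃)
open import Data.Fin.Subset.Properties using (_∈?_)
open import Data.Fin.Properties using (any?)
open import Data.List using (tabulate)
open import Data.Product using (_×_; ∃)
open import Data.Sum using (_⊎_)
open import Relation.Nullary using (Dec; ¬_; does)
open import Relation.Nullary.Decidable using (_×-dec_; ¬?)
open import Relation.Binary.PropositionalEquality using (_≡_; _≢_)
open import Data.Bool using (if_then_else_)

sumFin : (n : ℕ) → (Fin n → ℕ) → ℕ
sumFin zero    f = 0
sumFin (suc n) f = f zero + sumFin n (λ x → f (suc x))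

sumFinℚ : (n : ℕ) → (Fin n → ℚ) → ℚ
sumFinℚ zero    f = 0ℚ
sumFinℚ (suc n) f = f zero +ℚ sumFinℚ n (λ x → f (suc x))

𝟙 : {P : Set} → Dec P → ℕ
𝟙 d = if does d then 1 else 0


-- the fraction N / k as a rational; k = 0 never occurs in use (all A_i nonempty)
frac : ℕ → ℕ → ℚ
frac N zero    = 0ℚ
frac N (suc k) = (+ N) / suc k

module _ {n m : ℕ} (_⊕_ : Fin n → Fin n → Fin n) (0# : Fin n) (⊖_ : Fin n → Fin n)
         (A : Fin m → Subset n) where

  _⊝_ : Fin n → Fin n → Fin n
  a ⊝ b = a ⊕ (⊖ b)

  InOther : Fin m → Fin n → Set
  InOther j b = ∃ λ i → (i ≢ j) × (b ∈ A i)

  inOther? : (j : Fin m) (b : Fin n) → Dec (InOther j b)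
  inOther? j b = any? (λ i → ¬? (i ≟ j) ×-dec (b ∈? A i))

  N : Fin m → Fin n → ℕ
  N j δ = sumFin n (λ a → sumFin n (λ b →
            𝟙 ((a ∈? A j) ×-dec (inOther? j b) ×-dec ((a ⊝ b) ≟ δ))))

  Bimodal : Set
  Bimodal = ∀ (j : Fin m) (δ : Fin n) → δ ≢ 0# → (N j δ ≡ 0) ⊎ (N j δ ≡ ∣ A j ∣)

  RWEDF : ℕ → Set
  RWEDF ℓ = ∀ (δ : Fin n) → δ ≢ 0# →
            sumFinℚ m (λ i → frac (N i δ) ∣ A i ∣) ≡ (+ ℓ) / 1

IsDifferenceSet : {n : ℕ} (_⊕_ : Fin n → Fin n → Fin n) (0# : Fin n) (⊖_ : Fin n → Fin n)
                  (k λ' : ℕ) (D : Subset n) → Set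
IsDifferenceSet {n} _⊕_ 0# ⊖_ k λ' D =
  (∣ D ∣ ≡ k) ×
  (∀ (δ : Fin n) → δ ≢ 0# →
     sumFin n (λ d₁ → sumFin n (λ d₂ →
       𝟙 ((d₁ ∈? D) ×-dec (d₂ ∈? D) ×-dec ((d₁ ⊕ (⊖ d₂)) ≟ δ)))) ≡ λ')

⋃ᵢ : {n m : ℕ} → (Fin m → Subset n) → Subset n
⋃ᵢ A = ⋃ (tabulate A)

module Submission where

-- Let A₁,…,A_m be disjoint nonempty blocks in a finite abelian group G and
-- say that a ∈ A_j is "hit" by δ when a - δ lies in some other block, so that
-- N_j(δ) is the number of hit elements of A_j.
--
-- (⇒) Bimodality makes each N_i(δ)/k_i equal to 0 or 1, so the RWEDF condition
-- with ℓ = 1 says that for δ ≠ 0 exactly one block is "active" (N_i(δ) ≠ 0),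
-- and an active block is hit in all of its elements.  Applying uniqueness of
-- the active block to -δ gives the translation lemma: if a ∈ A_j and
-- a - δ ∈ A_i (i ≠ j), then x - δ ∈ A_i for every x ∈ A_j.  Two distinct
-- elements a, a' of one block contradict the translation lemma for
-- δ = a - a', so every block is a singleton.
-- (⇐) For singleton blocks frac N_i(δ) k_i = N_i(δ), and Σᵢ N_i(δ) counts the
-- representations δ = d₁ - d₂ inside D = ⋃ A_i, while |D| = Σ k_i = m; hence
-- the RWEDF condition is exactly the (n, m, 1) difference-set condition.

open import Defs
open import Data.Nat using (ℕ; zero; suc; _+_; _≤_; _<_; z≤n)
import Data.Nat.Properties as ℕP
open import Data.Fin using (Fin; zero; suc; _≟_)
open import Data.Fin.Properties using (suc-injective)
open import Data.Fin.Subset using (Subset; _∈_; ∣_∣; _∩_; Empty; Nonempty; inside; outside)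
open import Data.Fin.Subset.Properties using (_∈?_; x∈p∩q⁺; ∉⊥; x∈p∪q⁻; p⊆p∪q; q⊆p∪q)
open import Data.Vec using ([]; _∷_)
open import Data.Product using (_×_; ∃; _,_; proj₁; proj₂)
open import Data.Sum using (_⊎_; inj₁; inj₂)
open import Data.Empty using (⊥-elim)
open import Function using (_∘_)
open import Relation.Nullary using (Dec; yes; no; ¬_)
open import Relation.Nullary.Decidable using (_×-dec_; ¬?; decidable-stable)
open import Relation.Binary.PropositionalEquality
open import Algebra.Structures using (IsAbelianGroup)
open import Algebra.Bundles using (AbelianGroup)
open import Function.Bundles using (_⇔_; mk⇔)
import Data.Integer as ℤ
import Data.Integer.Properties as ℤP
open import Data.Rational as ℚ using (ℚ; mkℚ; _/_; ↥_)
import Data.Rational.Properties as ℚP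
import Data.Rational.Unnormalised as ℚᵘ
import Data.Nat.Coprimality as Coprime

sum-cong : ∀ n {f g : Fin n → ℕ} → (∀ x → f x ≡ g x) → sumFin n f ≡ sumFin n g
sum-cong zero    f≗g = refl
sum-cong (suc n) f≗g = cong₂ _+_ (f≗g zero) (sum-cong n (f≗g ∘ suc))

sum-zero : ∀ n {f : Fin n → ℕ} → (∀ x → f x ≡ 0) → sumFin n f ≡ 0
sum-zero zero    f≗0 = refl
sum-zero (suc n) f≗0 = cong₂ _+_ (f≗0 zero) (sum-zero n (f≗0 ∘ suc))

sum-ones : ∀ n → sumFin n (λ _ → 1) ≡ n
sum-ones zero    = refl
sum-ones (suc n) = cong suc (sum-ones n)

sum-+ : ∀ n (f g : Fin n → ℕ) → sumFin n (λ x → f x + g x) ≡ sumFin n f + sumFin n g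
sum-+ zero    f g = refl
sum-+ (suc n) f g = begin
  (f zero + g zero) + sumFin n (λ x → f (suc x) + g (suc x))
    ≡⟨ cong ((f zero + g zero) +_) (sum-+ n (f ∘ suc) (g ∘ suc)) ⟩
  (f zero + g zero) + (sumFin n (f ∘ suc) + sumFin n (g ∘ suc))
    ≡⟨ interchange (f zero) (g zero) (sumFin n (f ∘ suc)) (sumFin n (g ∘ suc)) ⟩
  (f zero + sumFin n (f ∘ suc)) + (g zero + sumFin n (g ∘ suc)) ∎
  where
  open ≡-Reasoning
  open import Algebra.Properties.CommutativeSemigroup ℕP.+-commutativeSemigroup using (interchange)

sum-swap : ∀ n m (f : Fin n → Fin m → ℕ) →
  sumFin n (λ a → sumFin m (f a)) ≡ sumFin m (λ j → sumFin n (λ a → f a j))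
sum-swap zero    m f = sym (sum-zero m (λ _ → refl))
sum-swap (suc n) m f =
  trans (cong (sumFin m (f zero) +_) (sum-swap n m (f ∘ suc)))
        (sym (sum-+ m (f zero) (λ j → sumFin n (λ a → f (suc a) j))))

term≤sum : ∀ n (f : Fin n → ℕ) i → f i ≤ sumFin n f
term≤sum (suc n) f zero    = ℕP.m≤m+n _ _
term≤sum (suc n) f (suc i) = ℕP.≤-trans (term≤sum n (f ∘ suc) i) (ℕP.m≤n+m _ _)

two-terms≤sum : ∀ n (f : Fin n → ℕ) i j → i ≢ j → f i + f j ≤ sumFin n f
two-terms≤sum (suc n) f zero    zero    i≢j = ⊥-elim (i≢j refl)
two-terms≤sum (suc n) f zero    (suc j) i≢j = ℕP.+-monoʳ-≤ (f zero) (term≤sum n (f ∘ suc) j)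
two-terms≤sum (suc n) f (suc i) zero    i≢j =
  subst (_≤ sumFin (suc n) f) (ℕP.+-comm (f zero) (f (suc i)))
        (ℕP.+-monoʳ-≤ (f zero) (term≤sum n (f ∘ suc) i))
two-terms≤sum (suc n) f (suc i) (suc j) i≢j =
  ℕP.≤-trans (two-terms≤sum n (f ∘ suc) i j (i≢j ∘ cong suc)) (ℕP.m≤n+m _ _)

sum-point : ∀ n (f : Fin n → ℕ) c → (∀ x → x ≢ c → f x ≡ 0) → sumFin n f ≡ f c
sum-point (suc n) f zero    f≡0 =
  trans (cong (f zero +_) (sum-zero n (λ x → f≡0 (suc x) λ ()))) (ℕP.+-identityʳ _)
sum-point (suc n) f (suc c) f≡0 =
  cong₂ _+_ (f≡0 zero λ ()) (sum-point n (f ∘ suc) c (λ x x≢c → f≡0 (suc x) (x≢c ∘ suc-injective)))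

sum-nonzero : ∀ n (f : Fin n → ℕ) → sumFin n f ≢ 0 → ∃ λ i → f i ≢ 0
sum-nonzero zero    f sum≢0 = ⊥-elim (sum≢0 refl)
sum-nonzero (suc n) f sum≢0 with f zero ℕP.≟ 0
... | no  f0≢0 = zero , f0≢0
... | yes f0≡0 with sum-nonzero n (f ∘ suc) (sum≢0 ∘ cong₂ _+_ f0≡0)
...   | i , fi≢0 = suc i , fi≢0

sum-mono : ∀ n (f g : Fin n → ℕ) → (∀ x → f x ≤ g x) → sumFin n f ≤ sumFin n g
sum-mono zero    f g f≤g = z≤n
sum-mono (suc n) f g f≤g = ℕP.+-mono-≤ (f≤g zero) (sum-mono n (f ∘ suc) (g ∘ suc) (f≤g ∘ suc))

sum-mono-< : ∀ n (f g : Fin n → ℕ) → (∀ x → f x ≤ g x) → ∀ i → f i < g i → sumFin n f < sumFin n g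
sum-mono-< (suc n) f g f≤g zero    fi<gi = ℕP.+-mono-<-≤ fi<gi (sum-mono n (f ∘ suc) (g ∘ suc) (f≤g ∘ suc))
sum-mono-< (suc n) f g f≤g (suc i) fi<gi = ℕP.+-mono-≤-< (f≤g zero) (sum-mono-< n (f ∘ suc) (g ∘ suc) (f≤g ∘ suc) i fi<gi)

𝟙-yes : {P : Set} → P → (P? : Dec P) → 𝟙 P? ≡ 1
𝟙-yes p (yes _) = refl
𝟙-yes p (no ¬p) = ⊥-elim (¬p p)

𝟙-no : {P : Set} → ¬ P → (P? : Dec P) → 𝟙 P? ≡ 0
𝟙-no ¬p (yes p) = ⊥-elim (¬p p)
𝟙-no ¬p (no _)  = refl

𝟙-cong : {P Q : Set} → (P → Q) → (Q → P) → (P? : Dec P) (Q? : Dec Q) → 𝟙 P? ≡ 𝟙 Q?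
𝟙-cong f g (yes p) Q? = sym (𝟙-yes (f p) Q?)
𝟙-cong f g (no ¬p) Q? = sym (𝟙-no (¬p ∘ g) Q?)

𝟙-mono : {P Q : Set} → (P → Q) → (P? : Dec P) (Q? : Dec Q) → 𝟙 P? ≤ 𝟙 Q?
𝟙-mono f (yes p) Q? = ℕP.≤-reflexive (sym (𝟙-yes (f p) Q?))
𝟙-mono f (no _)  Q? = z≤n

𝟙-nonzero : {P : Set} (P? : Dec P) → 𝟙 P? ≢ 0 → P
𝟙-nonzero (yes p) _   = p
𝟙-nonzero (no _)  𝟙≢0 = ⊥-elim (𝟙≢0 refl)

count : ∀ k {P : Fin k → Set} → (∀ x → Dec (P x)) → ℕ
count k P? = sumFin k (λ x → 𝟙 (P? x))

count-witness : ∀ k {P : Fin k → Set} (P? : ∀ x → Dec (P x)) → count k P? ≢ 0 → ∃ P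
count-witness k P? count≢0 with sum-nonzero k (λ x → 𝟙 (P? x)) count≢0
... | x , 𝟙≢0 = x , 𝟙-nonzero (P? x) 𝟙≢0

count-pos : ∀ k {P : Fin k → Set} (P? : ∀ x → Dec (P x)) x → P x → count k P? ≢ 0
count-pos k P? x px = ℕP.m<n⇒n≢0 (subst (_≤ count k P?) (𝟙-yes px (P? x)) (term≤sum k _ x))

count-saturated : ∀ k {P Q : Fin k → Set} (P? : ∀ x → Dec (P x)) (Q? : ∀ x → Dec (Q x)) →
  (∀ {x} → P x → Q x) → count k P? ≡ count k Q? → ∀ x → Q x → P x
count-saturated k P? Q? P⊆Q same x qx with P? x
... | yes px = px
... | no ¬px = ⊥-elim (ℕP.<-irrefl same (sum-mono-< k _ _ (λ y → 𝟙-mono P⊆Q (P? y) (Q? y)) x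
                 (subst₂ _<_ (sym (𝟙-no ¬px (P? x))) (sym (𝟙-yes qx (Q? x))) ℕP.0<1+n)))

count-unique : ∀ k {P : Fin k → Set} (P? : ∀ x → Dec (P x)) → count k P? ≤ 1 →
  ∀ {x y} → P x → P y → x ≡ y
count-unique k P? count≤1 {x} {y} px py with x ≟ y
... | yes x≡y = x≡y
... | no  x≢y = ⊥-elim (ℕP.<-irrefl refl (ℕP.≤-trans
       (subst₂ (λ a b → 2 ≤ a + b) (sym (𝟙-yes px (P? x))) (sym (𝟙-yes py (P? y))) ℕP.≤-refl)
       (ℕP.≤-trans (two-terms≤sum k _ x y x≢y) count≤1)))

count-one : ∀ k {P : Fin k → Set} (P? : ∀ x → Dec (P x)) {c} → P c → (∀ x → P x → x ≡ c) →
  count k P? ≡ 1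
count-one k P? {c} pc only =
  trans (sum-point k _ c (λ x x≢c → 𝟙-no (x≢c ∘ only x) (P? x))) (𝟙-yes pc (P? c))

count-exclusive : ∀ m {P : Fin m → Set} {Q : Set} (P? : ∀ j → Dec (P j)) (Q? : Dec Q) →
  (∀ {i j} → P i → P j → i ≡ j) → (Q → ∃ P) → (∀ {j} → P j → Q) → count m P? ≡ 𝟙 Q?
count-exclusive m P? (yes q) exclusive cover sound with cover q
... | j , pj = count-one m P? pj (λ i pi → exclusive pi pj)
count-exclusive m P? (no ¬q) exclusive cover sound = sum-zero m (λ j → 𝟙-no (¬q ∘ sound) (P? j))

card-count : ∀ n (p : Subset n) → ∣ p ∣ ≡ count n (_∈? p)
card-count zero    []            = refl
card-count (suc n) (inside ∷ p)  = cong suc (card-count n p)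
card-count (suc n) (outside ∷ p) = card-count n p

∈⋃ᵢ⁻ : ∀ {n} m (A : Fin m → Subset n) {x} → x ∈ ⋃ᵢ A → ∃ λ i → x ∈ A i
∈⋃ᵢ⁻ zero    A x∈ = ⊥-elim (∉⊥ x∈)
∈⋃ᵢ⁻ (suc m) A x∈ with x∈p∪q⁻ (A zero) (⋃ᵢ (A ∘ suc)) x∈
... | inj₁ x∈A₀ = zero , x∈A₀
... | inj₂ x∈⋃ with ∈⋃ᵢ⁻ m (A ∘ suc) x∈⋃
...   | i , x∈Aᵢ = suc i , x∈Aᵢ

∈⋃ᵢ⁺ : ∀ {n} m (A : Fin m → Subset n) {x} i → x ∈ A i → x ∈ ⋃ᵢ A
∈⋃ᵢ⁺ (suc m) A zero    x∈ = p⊆p∪q (⋃ᵢ (A ∘ suc)) x∈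
∈⋃ᵢ⁺ (suc m) A (suc i) x∈ = q⊆p∪q (A zero) (⋃ᵢ (A ∘ suc)) (∈⋃ᵢ⁺ m (A ∘ suc) i x∈)

⌜_⌝ : ℕ → ℚ
⌜ k ⌝ = (ℤ.+ k) / 1

⌜⌝-normal : ∀ k → ⌜ k ⌝ ≡ mkℚ (ℤ.+ k) 0 (Coprime.sym (Coprime.1-coprimeTo k))
⌜⌝-normal k = ℚP.↥p/↧p≡p (mkℚ (ℤ.+ k) 0 (Coprime.sym (Coprime.1-coprimeTo k)))

⌜⌝-injective : ∀ {a b} → ⌜ a ⌝ ≡ ⌜ b ⌝ → a ≡ b
⌜⌝-injective {a} {b} eq = ℤP.+-injective (cong ↥_ (trans (sym (⌜⌝-normal a)) (trans eq (⌜⌝-normal b))))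

⌜⌝-+ : ∀ a b → ⌜ a ⌝ ℚ.+ ⌜ b ⌝ ≡ ⌜ a + b ⌝
⌜⌝-+ a b = trans (cong₂ ℚ._+_ (⌜⌝-normal a) (⌜⌝-normal b)) (ℚP./-cong numerator refl)
  where
  numerator : (ℤ.+ a) ℤ.* (ℤ.+ 1) ℤ.+ (ℤ.+ b) ℤ.* (ℤ.+ 1) ≡ ℤ.+ (a + b)
  numerator = trans (cong₂ ℤ._+_ (ℤP.*-identityʳ (ℤ.+ a)) (ℤP.*-identityʳ (ℤ.+ b))) (sym (ℤP.pos-+ a b))

sumℚ-cong : ∀ m {f g : Fin m → ℚ} → (∀ x → f x ≡ g x) → sumFinℚ m f ≡ sumFinℚ m g
sumℚ-cong zero    f≗g = refl
sumℚ-cong (suc m) f≗g = cong₂ ℚ._+_ (f≗g zero) (sumℚ-cong m (f≗g ∘ suc))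

sum-⌜⌝ : ∀ m (f : Fin m → ℕ) → sumFinℚ m (λ i → ⌜ f i ⌝) ≡ ⌜ sumFin m f ⌝
sum-⌜⌝ zero    f = refl
sum-⌜⌝ (suc m) f = trans (cong (⌜ f zero ⌝ ℚ.+_) (sum-⌜⌝ m (f ∘ suc))) (⌜⌝-+ (f zero) (sumFin m (f ∘ suc)))

frac-bimodal : ∀ {N k} → N ≡ 0 ⊎ N ≡ k → k ≢ 0 → frac N k ≡ ⌜ 𝟙 (¬? (N ℕP.≟ 0)) ⌝
frac-bimodal {k = zero}  _            k≢0 = ⊥-elim (k≢0 refl)
frac-bimodal {k = suc k} (inj₁ refl) _   = ℚP.0/n≡0 (suc k)
frac-bimodal {k = suc k} (inj₂ refl) _   =
  ℚP.fromℚᵘ-cong {ℚᵘ.mkℚᵘ (ℤ.+ suc k) k} {ℚᵘ.mkℚᵘ (ℤ.+ 1) 0} (ℚᵘ.*≡* (ℤP.*-comm (ℤ.+ suc k) (ℤ.+ 1)))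

module SubtractionLaws {c} {X : Set c} {_⊕_ : X → X → X} {0# : X} {⊖_ : X → X}
                       (isAG : IsAbelianGroup _≡_ _⊕_ 0# ⊖_) where

  private
    G : AbelianGroup c c
    G = record { isAbelianGroup = isAG }

  open AbelianGroup G using (assoc; comm; identityʳ; inverseʳ)
  open import Algebra.Properties.AbelianGroup G using (⁻¹-anti-homo‿-; xyx⁻¹≈y; x∙y⁻¹≈ε⇒x≈y; ε⁻¹≈ε)

  infixl 6 _-_
  _-_ : X → X → X
  a - b = a ⊕ (⊖ b)

  sub-zero : ∀ a → a - 0# ≡ a
  sub-zero a = trans (cong (a ⊕_) ε⁻¹≈ε) (identityʳ a)

  sub≡0⇒≡ : ∀ {a b} → a - b ≡ 0# → a ≡ b
  sub≡0⇒≡ = x∙y⁻¹≈ε⇒x≈y _ _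

  sub-sub : ∀ a b → a - (a - b) ≡ b
  sub-sub a b = trans (cong (a ⊕_) (⁻¹-anti-homo‿- a b)) (trans (sym (assoc a b (⊖ a))) (xyx⁻¹≈y a b))

  sub-sub-neg : ∀ a δ → (a - δ) - (⊖ δ) ≡ a
  sub-sub-neg a δ = trans (assoc a (⊖ δ) (⊖ (⊖ δ))) (trans (cong (a ⊕_) (inverseʳ (⊖ δ))) (identityʳ a))

  sub-exchange : ∀ a b x → b - (a - x) ≡ x - (a - b)
  sub-exchange a b x = begin
    b ⊕ (⊖ (a - x)) ≡⟨ cong (b ⊕_) (⁻¹-anti-homo‿- a x) ⟩
    b ⊕ (x - a)     ≡⟨ sym (assoc b x (⊖ a)) ⟩
    (b ⊕ x) - a     ≡⟨ cong (_- a) (comm b x) ⟩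
    (x ⊕ b) - a     ≡⟨ assoc x b (⊖ a) ⟩
    x ⊕ (b - a)     ≡⟨ cong (x ⊕_) (sym (⁻¹-anti-homo‿- a b)) ⟩
    x - (a - b)     ∎
    where open ≡-Reasoning

  sub-fixed⇒0 : ∀ a δ → a - δ ≡ a → δ ≡ 0#
  sub-fixed⇒0 a δ a-δ≡a = trans (sym (sub-sub a δ)) (trans (cong (a -_) a-δ≡a) (inverseʳ a))

module Collection {n m : ℕ} {_⊕_ : Fin n → Fin n → Fin n} {0# : Fin n} {⊖_ : Fin n → Fin n}
  (isAG : IsAbelianGroup _≡_ _⊕_ 0# ⊖_) (A : Fin m → Subset n)
  (disjoint : ∀ i j → i ≢ j → Empty (A i ∩ A j)) where

  open SubtractionLaws isAG

  𝒩 : Fin m → Fin n → ℕ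
  𝒩 = N _⊕_ 0# ⊖_ A

  Other : Fin m → Fin n → Set
  Other = InOther _⊕_ 0# ⊖_ A

  representations : Subset n → Fin n → ℕ
  representations D δ = sumFin n (λ d₁ → sumFin n (λ d₂ →
    𝟙 ((d₁ ∈? D) ×-dec (d₂ ∈? D) ×-dec ((d₁ ⊕ (⊖ d₂)) ≟ δ))))

  sum-pinned : ∀ {P : Set} {Q : Fin n → Set} (P? : Dec P) (Q? : ∀ b → Dec (Q b)) a δ →
    sumFin n (λ b → 𝟙 (P? ×-dec Q? b ×-dec ((a - b) ≟ δ))) ≡ 𝟙 (P? ×-dec Q? (a - δ))
  sum-pinned P? Q? a δ = trans
    (sum-point n _ (a - δ) (λ b b≢a-δ → 𝟙-no (λ { (_ , _ , a-b≡δ) → b≢a-δ (pinned a-b≡δ) })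
                                              (P? ×-dec Q? b ×-dec ((a - b) ≟ δ))))
    (𝟙-cong (λ { (p , q , _) → p , q }) (λ { (p , q) → p , q , sub-sub a δ })
            (P? ×-dec Q? (a - δ) ×-dec ((a - (a - δ)) ≟ δ)) (P? ×-dec Q? (a - δ)))
    where
    pinned : ∀ {b} → a - b ≡ δ → b ≡ a - δ
    pinned {b} a-b≡δ = trans (sym (sub-sub a b)) (cong (a -_) a-b≡δ)

  block-unique : ∀ {x i j} → x ∈ A i → x ∈ A j → i ≡ j
  block-unique {x} {i} {j} x∈Aᵢ x∈Aⱼ with i ≟ j
  ... | yes i≡j = i≡j
  ... | no  i≢j = ⊥-elim (disjoint i j i≢j (x , x∈p∩q⁺ (x∈Aᵢ , x∈Aⱼ)))

  Hit : Fin m → Fin n → Fin n → Set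
  Hit j δ a = a ∈ A j × Other j (a - δ)

  hit? : ∀ j δ a → Dec (Hit j δ a)
  hit? j δ a = (a ∈? A j) ×-dec inOther? _⊕_ 0# ⊖_ A j (a - δ)

  N≡hits : ∀ j δ → 𝒩 j δ ≡ count n (hit? j δ)
  N≡hits j δ = sum-cong n (λ a → sum-pinned (a ∈? A j) (inOther? _⊕_ 0# ⊖_ A j) a δ)

  hit⇒N≢0 : ∀ {j δ a} → Hit j δ a → 𝒩 j δ ≢ 0
  hit⇒N≢0 {j} {δ} {a} h = subst (_≢ 0) (sym (N≡hits j δ)) (count-pos n (hit? j δ) a h)

  N≢0⇒hit : ∀ {j δ} → 𝒩 j δ ≢ 0 → ∃ (Hit j δ)
  N≢0⇒hit {j} {δ} N≢0 = count-witness n (hit? j δ) (N≢0 ∘ trans (N≡hits j δ))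

  all-hit : ∀ {j δ} → 𝒩 j δ ≡ ∣ A j ∣ → ∀ x → x ∈ A j → Hit j δ x
  all-hit {j} {δ} N≡k = count-saturated n (hit? j δ) (_∈? A j) proj₁
    (trans (sym (N≡hits j δ)) (trans N≡k (card-count n (A j))))

  hit⇒δ≢0 : ∀ {j δ a} → Hit j δ a → δ ≢ 0#
  hit⇒δ≢0 {j} {δ} {a} (a∈Aⱼ , i , i≢j , a-δ∈Aᵢ) refl =
    i≢j (block-unique (subst (_∈ A i) (sub-zero a) a-δ∈Aᵢ) a∈Aⱼ)

  reverse-hit : ∀ {i j δ a} → a ∈ A j → (a - δ) ∈ A i → i ≢ j → Hit i (⊖ δ) (a - δ)
  reverse-hit {i} {j} {δ} {a} a∈Aⱼ a-δ∈Aᵢ i≢j =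
    a-δ∈Aᵢ , j , i≢j ∘ sym , subst (_∈ A j) (sym (sub-sub-neg a δ)) a∈Aⱼ

  card-⋃ᵢ : ∣ ⋃ᵢ A ∣ ≡ sumFin m (λ j → ∣ A j ∣)
  card-⋃ᵢ = begin
    ∣ ⋃ᵢ A ∣                                   ≡⟨ card-count n (⋃ᵢ A) ⟩
    count n (_∈? ⋃ᵢ A)                          ≡⟨ sum-cong n (λ a → sym (count-exclusive m (λ j → a ∈? A j)
                                                      (a ∈? ⋃ᵢ A) block-unique (∈⋃ᵢ⁻ m A) (∈⋃ᵢ⁺ m A _))) ⟩
    sumFin n (λ a → count m (λ j → a ∈? A j))   ≡⟨ sum-swap n m (λ a j → 𝟙 (a ∈? A j)) ⟩
    sumFin m (λ j → count n (_∈? A j))          ≡⟨ sum-cong m (λ j → sym (card-count n (A j))) ⟩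
    sumFin m (λ j → ∣ A j ∣)                    ∎
    where open ≡-Reasoning

  -- (⇒) A bimodal RWEDF with ℓ = 1 consists of singletons

  module FromRWEDF (nonempty : ∀ i → Nonempty (A i)) (bimodal : Bimodal _⊕_ 0# ⊖_ A)
                   (rwedf : RWEDF _⊕_ 0# ⊖_ A 1) where

    active? : ∀ δ i → Dec (𝒩 i δ ≢ 0)
    active? δ i = ¬? (𝒩 i δ ℕP.≟ 0)

    size≢0 : ∀ i → ∣ A i ∣ ≢ 0
    size≢0 i = subst (_≢ 0) (sym (card-count n (A i))) (count-pos n (_∈? A i) _ (proj₂ (nonempty i)))

    one-active : ∀ {δ} → δ ≢ 0# → count m (active? δ) ≡ 1
    one-active {δ} δ≢0 = ⌜⌝-injective (begin
      ⌜ count m (active? δ) ⌝                  ≡⟨ sum-⌜⌝ m _ ⟨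
      sumFinℚ m (λ i → ⌜ 𝟙 (active? δ i) ⌝)    ≡⟨ sumℚ-cong m (λ i → frac-bimodal (bimodal i δ δ≢0) (size≢0 i)) ⟨
      sumFinℚ m (λ i → frac (𝒩 i δ) ∣ A i ∣)   ≡⟨ rwedf δ δ≢0 ⟩
      ⌜ 1 ⌝                                    ∎)
      where open ≡-Reasoning

    active-unique : ∀ {δ i j} → δ ≢ 0# → 𝒩 i δ ≢ 0 → 𝒩 j δ ≢ 0 → i ≡ j
    active-unique δ≢0 = count-unique m (active? _) (ℕP.≤-reflexive (one-active δ≢0))

    active-all-hit : ∀ {j δ} → δ ≢ 0# → 𝒩 j δ ≢ 0 → ∀ x → x ∈ A j → Hit j δ x
    active-all-hit {j} {δ} δ≢0 N≢0 with bimodal j δ δ≢0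
    ... | inj₁ N≡0 = ⊥-elim (N≢0 N≡0)
    ... | inj₂ N≡k = all-hit N≡k

    translate : ∀ {i j δ a} → a ∈ A j → (a - δ) ∈ A i → i ≢ j → ∀ x → x ∈ A j → (x - δ) ∈ A i
    translate {i} {j} {δ} {a} a∈Aⱼ a-δ∈Aᵢ i≢j x x∈Aⱼ
      with active-all-hit (hit⇒δ≢0 hit) (hit⇒N≢0 hit) x x∈Aⱼ
      where hit = a∈Aⱼ , i , i≢j , a-δ∈Aᵢ
    ... | _ , q , q≢j , x-δ∈A_q = subst (λ k → (x - δ) ∈ A k) q≡i x-δ∈A_q
      where
      back : Hit i (⊖ δ) (a - δ)
      back = reverse-hit a∈Aⱼ a-δ∈Aᵢ i≢j
      q≡i : q ≡ i
      q≡i = active-unique (hit⇒δ≢0 back) (hit⇒N≢0 (reverse-hit x∈Aⱼ x-δ∈A_q q≢j)) (hit⇒N≢0 back)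

    -- No hit is caused by the difference of two elements of one block:
    -- translating by it would force two different blocks to meet.
    no-inner-hit : ∀ {j l a a' x} → a ∈ A j → a' ∈ A j → ¬ Hit l (a - a') x
    no-inner-hit {j} {l} {a} {a'} {x} a∈Aⱼ a'∈Aⱼ (x∈Aₗ , p , p≢l , x-h∈Aₚ) with j ≟ l
    ... | yes refl = p≢l (block-unique a'∈Aₚ a'∈Aⱼ)
      where
      a'∈Aₚ : a' ∈ A p
      a'∈Aₚ = subst (_∈ A p) (sub-sub a a') (translate x∈Aₗ x-h∈Aₚ p≢l a a∈Aⱼ)
    ... | no  j≢l  = p≢l (block-unique x-h∈Aₚ x-h∈Aₗ)
      where
      x-h∈Aₗ : (x - (a - a')) ∈ A l
      x-h∈Aₗ = subst (_∈ A l) (sub-exchange a a' x)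
                 (translate a∈Aⱼ (subst (_∈ A l) (sym (sub-sub a x)) x∈Aₗ) (j≢l ∘ sym) a' a'∈Aⱼ)

    -- Hence distinct a, a' in one block are impossible: a - a' ≠ 0 must cause a hit.
    at-most-one : ∀ {j a a'} → a ∈ A j → a' ∈ A j → a ≡ a'
    at-most-one {j} {a} {a'} a∈Aⱼ a'∈Aⱼ = decidable-stable (a ≟ a') λ a≢a' →
      let h≢0 : a - a' ≢ 0#
          h≢0 = a≢a' ∘ sub≡0⇒≡
          (l , N≢0) = count-witness m (active? (a - a')) (ℕP.1+n≢0 ∘ trans (sym (one-active h≢0)))
          (x , hit) = N≢0⇒hit N≢0
      in no-inner-hit a∈Aⱼ a'∈Aⱼ hit

    sizes-one : ∀ j → ∣ A j ∣ ≡ 1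
    sizes-one j with nonempty j
    ... | c , c∈Aⱼ = trans (card-count n (A j)) (count-one n (_∈? A j) c∈Aⱼ (λ x x∈Aⱼ → at-most-one x∈Aⱼ c∈Aⱼ))

  -- Collections of singletons

  module Singletons (singleton : ∀ j → ∣ A j ∣ ≡ 1) where

    sole : ∀ {j x y} → x ∈ A j → y ∈ A j → x ≡ y
    sole {j} = count-unique n (_∈? A j) (ℕP.≤-reflexive (trans (sym (card-count n (A j))) (singleton j)))

    card-union : ∣ ⋃ᵢ A ∣ ≡ m
    card-union = trans card-⋃ᵢ (trans (sum-cong m singleton) (sum-ones m))

    sum-N : ∀ {δ} → δ ≢ 0# → sumFin m (λ j → 𝒩 j δ) ≡ representations (⋃ᵢ A) δ
    sum-N {δ} δ≢0 = begin
      sumFin m (λ j → 𝒩 j δ)                       ≡⟨ sum-cong m (λ j → N≡hits j δ) ⟩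
      sumFin m (λ j → count n (hit? j δ))          ≡⟨ sum-swap n m (λ a j → 𝟙 (hit? j δ a)) ⟨
      sumFin n (λ a → count m (λ j → hit? j δ a))  ≡⟨ sum-cong n (λ a → count-exclusive m (λ j → hit? j δ a)
                                                        ((a ∈? D) ×-dec ((a - δ) ∈? D))
                                                        (λ hᵢ hⱼ → block-unique (proj₁ hᵢ) (proj₁ hⱼ)) split join) ⟩
      sumFin n (λ a → 𝟙 ((a ∈? D) ×-dec ((a - δ) ∈? D)))
                                                   ≡⟨ sum-cong n (λ a → sum-pinned (a ∈? D) (_∈? D) a δ) ⟨
      representations D δ                          ∎
      where
      open ≡-Reasoning
      D : Subset n
      D = ⋃ᵢ A
      split : ∀ {a} → a ∈ D × (a - δ) ∈ D → ∃ λ j → Hit j δ a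
      split {a} (a∈D , a-δ∈D) with ∈⋃ᵢ⁻ m A a∈D | ∈⋃ᵢ⁻ m A a-δ∈D
      ... | j , a∈Aⱼ | i , a-δ∈Aᵢ = j , a∈Aⱼ , i , i≢j , a-δ∈Aᵢ
        where
        i≢j : i ≢ j
        i≢j refl = δ≢0 (sub-fixed⇒0 a δ (sole a-δ∈Aᵢ a∈Aⱼ))
      join : ∀ {j a} → Hit j δ a → a ∈ D × (a - δ) ∈ D
      join {j} (a∈Aⱼ , i , _ , a-δ∈Aᵢ) = ∈⋃ᵢ⁺ m A j a∈Aⱼ , ∈⋃ᵢ⁺ m A i a-δ∈Aᵢ

    rwedf-sum : ∀ δ → sumFinℚ m (λ i → frac (𝒩 i δ) ∣ A i ∣) ≡ ⌜ sumFin m (λ j → 𝒩 j δ) ⌝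
    rwedf-sum δ = trans (sumℚ-cong m (λ i → cong (frac (𝒩 i δ)) (singleton i))) (sum-⌜⌝ m (λ j → 𝒩 j δ))

mainTheorem12 : (n m : ℕ) → 3 ≤ m →
    (_⊕_ : Fin n → Fin n → Fin n) (0# : Fin n) (⊖_ : Fin n → Fin n) →
    IsAbelianGroup _≡_ _⊕_ 0# ⊖_ →
    (A : Fin m → Subset n) →
    (∀ (i j : Fin m) → i ≢ j → Empty (A i ∩ A j)) →
    (∀ (i : Fin m) → Nonempty (A i)) →
    Bimodal _⊕_ 0# ⊖_ A →
    (RWEDF _⊕_ 0# ⊖_ A 1 ⇔
    ((∀ (i : Fin m) → ∣ A i ∣ ≡ 1) × IsDifferenceSet _⊕_ 0# ⊖_ m 1 (⋃ᵢ A)))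
mainTheorem12 n m _ _⊕_ 0# ⊖_ isAG A disjoint nonempty bimodal = mk⇔ to from
  where
  open Collection isAG A disjoint

  to : RWEDF _⊕_ 0# ⊖_ A 1 → (∀ i → ∣ A i ∣ ≡ 1) × IsDifferenceSet _⊕_ 0# ⊖_ m 1 (⋃ᵢ A)
  to rwedf = singleton , card-union , λ δ δ≢0 →
    trans (sym (sum-N δ≢0)) (⌜⌝-injective (trans (sym (rwedf-sum δ)) (rwedf δ δ≢0)))
    where
    singleton : ∀ i → ∣ A i ∣ ≡ 1
    singleton = FromRWEDF.sizes-one nonempty bimodal rwedf
    open Singletons singleton

  from : (∀ i → ∣ A i ∣ ≡ 1) × IsDifferenceSet _⊕_ 0# ⊖_ m 1 (⋃ᵢ A) → RWEDF _⊕_ 0# ⊖_ A 1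
  from (singleton , _ , differences) δ δ≢0 =
    trans (rwedf-sum δ) (cong ⌜_⌝ (trans (sum-N δ≢0) (differences δ δ≢0)))
    where open Singletons singleton
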